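{- Let $\mathcal{L}$ be a proper extension of $\mathcal{B}$. If $\mathcal{L}$ has interpolation, then either $\mathcal{L}=\mathcal{LP}$ or $\mathcal{ECQ}\subseteq\mathcal{L}$.
   Context: Formulas are built from atoms using $\wedge,\vee$, the unary ${ - }$ and constants $\top,\bot$. A logic is a relation $\vdash$ between sets of formulas and formulas satisfying reflexivity ($\varphi\vdash\varphi$), monotonicity, cut (if $\Gamma\vdash\varphi$ for all $\varphi\in\Phi$ and $\Phi\cup\Delta\vdash\psi$ then $\Gamma\cup\Delta\vdash\psi$) and structurality (closure under substitutions). A matrix $\langle A,F\rangle$ (algebra $A$, $F\subseteq A$) determines the logic where $\Gamma\vdash\varphi$ iff for every homomorphism $v$ from the formula algebra to $A$, $v[\Gamma]\subseteq F$ implies $v(\varphi)\in F$. Let $\mathbf{B_4}$ be the algebra on $\{f,n,b,t\}$ with lattice order $f<n<t$, $f<b<t$ ($n,b$ incomparable), $\wedge,\vee$ meet and join, $\top=t$, $\bot=f$, ${ - }t=f$, ${ - }f=t$, ${ - }n=n$, ${ - }b=b$. $\mathcal{B}$ is the logic of $\langle\mathbf{B_4},\{t,b\}\rangle$ and $\mathcal{LP}$ the logic of the subalgebra on $\{f,b,t\}$ with designated set $\{b,t\}$. $\mathcal{ECQ}$ is the least logic extending $\mathcal{B}$ in which $p,{ - }p\vdash q$ for atoms $p,q$. $\mathcal{L}$ extends $\mathcal{B}$ if $\vdash_{\mathcal{B}}\subseteq\vdash_{\mathcal{L}}$; proper if moreover $\mathcal{L}\neq\mathcal{B}$. $\mathcal{L}$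 has interpolation if whenever $\varphi\vdash_{\mathcal{L}}\psi$ there is $\chi$ with $\varphi\vdash_{\mathcal{L}}\chi$, $\chi\vdash_{\mathcal{L}}\psi$, and every atom of $\chi$ occurs in both $\varphi$ and $\psi$. -}

module Defs where

open import Level using (Level; _⊔_) renaming (suc to lsuc; zero to lzero)
open import Data.Nat using (ℕ)
open import Data.Product using (Σ; _×_; _,_)
open import Data.Sum using (_⊎_)
open import Data.Empty using (⊥)
open import Data.Unit using (⊤)
open import Relation.Nullary using (¬_)
open import Relation.Binary.PropositionalEquality using (_≡_; _≢_)

infixr 6 _∧_
infixr 5 _∨_
infix 7 ∼_

data Formula : Set where
  atom : ℕ → Formula
  _∧_  : Formula → Formula → Formula
  _∨_  : Formula → Formula → Formula
  ∼_   : Formula → Formula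
  top  : Formula
  bot  : Formula

data Occurs (n : ℕ) : Formula → Set where
  here : Occurs n (atom n)
  ∧ˡ   : ∀ {φ ψ} → Occurs n φ → Occurs n (φ ∧ ψ)
  ∧ʳ   : ∀ {φ ψ} → Occurs n ψ → Occurs n (φ ∧ ψ)
  ∨ˡ   : ∀ {φ ψ} → Occurs n φ → Occurs n (φ ∨ ψ)
  ∨ʳ   : ∀ {φ ψ} → Occurs n ψ → Occurs n (φ ∨ ψ)
  ∼i   : ∀ {φ} → Occurs n φ → Occurs n (∼ φ)

-- substitutions (endomorphisms of the formula algebra are determined by
-- their values on atoms)
Subst : Set
Subst = ℕ → Formula

_[_] : Formula → Subst → Formula
atom n  [ σ ] = σ n
(φ ∧ ψ) [ σ ] = (φ [ σ ]) ∧ (ψ [ σ ])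
(φ ∨ ψ) [ σ ] = (φ [ σ ]) ∨ (ψ [ σ ])
(∼ φ)   [ σ ] = ∼ (φ [ σ ])
top     [ σ ] = top
bot     [ σ ] = bot

FSet : Set₁
FSet = Formula → Set

_⊆_ : FSet → FSet → Set
Γ ⊆ Δ = ∀ φ → Γ φ → Δ φ

_∪_ : FSet → FSet → FSet
(Γ ∪ Δ) φ = Γ φ ⊎ Δ φ

｛_｝ : Formula → FSet
｛ φ ｝ ψ = ψ ≡ φ

pair : Formula → Formula → FSet
pair φ χ ψ = (ψ ≡ φ) ⊎ (ψ ≡ χ)

_⟨_⟩ : FSet → Subst → FSet
(Γ ⟨ σ ⟩) ψ = Σ Formula λ χ → Γ χ × (ψ ≡ χ [ σ ])

Rel : (ℓ : Level) → Set (lsuc ℓ)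
Rel ℓ = FSet → Formula → Set ℓ

record IsLogic {ℓ : Level} (_⊢_ : Rel ℓ) : Set (lsuc lzero ⊔ ℓ) where
  field
    reflexive   : ∀ φ → ｛ φ ｝ ⊢ φ
    monotone    : ∀ {Γ Δ φ} → Γ ⊆ Δ → Γ ⊢ φ → Δ ⊢ φ
    cut         : ∀ {Γ Φ Δ ψ} → (∀ φ → Φ φ → Γ ⊢ φ) → (Φ ∪ Δ) ⊢ ψ → (Γ ∪ Δ) ⊢ ψ
    structural  : ∀ {Γ φ} (σ : Subst) → Γ ⊢ φ → (Γ ⟨ σ ⟩) ⊢ (φ [ σ ])

record Logic (ℓ : Level) : Set (lsuc ℓ) where
  field
    _⊢_     : Rel ℓ
    isLogic : IsLogic _⊢_

_≤ᴿ_ : ∀ {ℓ ℓ'} → Rel ℓ → Rel ℓ' → Set (lsuc lzero ⊔ ℓ ⊔ ℓ')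
R ≤ᴿ S = ∀ Γ φ → R Γ φ → S Γ φ

_≈ᴿ_ : ∀ {ℓ ℓ'} → Rel ℓ → Rel ℓ' → Set (lsuc lzero ⊔ ℓ ⊔ ℓ')
R ≈ᴿ S = R ≤ᴿ S × S ≤ᴿ R

data B4 : Set where
  f n b t : B4

_⊓_ : B4 → B4 → B4
f ⊓ y = f
t ⊓ y = y
n ⊓ f = f
n ⊓ n = n
n ⊓ b = f
n ⊓ t = n
b ⊓ f = f
b ⊓ n = f
b ⊓ b = b
b ⊓ t = b

_⊔ᴮ_ : B4 → B4 → B4
t ⊔ᴮ y = t
f ⊔ᴮ y = y
n ⊔ᴮ f = n
n ⊔ᴮ n = n
n ⊔ᴮ b = t
n ⊔ᴮ t = t
b ⊔ᴮ f = b
b ⊔ᴮ n = t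
b ⊔ᴮ b = b
b ⊔ᴮ t = t

negᴮ : B4 → B4
negᴮ t = f
negᴮ f = t
negᴮ n = n
negᴮ b = b

⟦_⟧ : Formula → (ℕ → B4) → B4
⟦ atom k ⟧ v = v k
⟦ φ ∧ ψ ⟧ v = ⟦ φ ⟧ v ⊓ ⟦ ψ ⟧ v
⟦ φ ∨ ψ ⟧ v = ⟦ φ ⟧ v ⊔ᴮ ⟦ ψ ⟧ v
⟦ ∼ φ ⟧ v = negᴮ (⟦ φ ⟧ v)
⟦ top ⟧ v = t
⟦ bot ⟧ v = f

Des : B4 → Set
Des t = ⊤
Des b = ⊤
Des f = ⊥
Des n = ⊥

_⊢B_ : Rel lzero
Γ ⊢B φ = ∀ (v : ℕ → B4) → (∀ ψ → Γ ψ → Des (⟦ ψ ⟧ v)) → Des (⟦ φ ⟧ v)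

-- logic LP of the subalgebra on {f,b,t} with designated set {b,t}:
-- homomorphisms into the subalgebra = atom assignments avoiding n
-- ({f,b,t} is closed under all operations).
_⊢LP_ : Rel lzero
Γ ⊢LP φ = ∀ (v : ℕ → B4) → (∀ k → v k ≢ n) →
          (∀ ψ → Γ ψ → Des (⟦ ψ ⟧ v)) → Des (⟦ φ ⟧ v)

Extends : ∀ {ℓ} → Logic ℓ → Set (lsuc lzero ⊔ ℓ)
Extends L = _⊢B_ ≤ᴿ Logic._⊢_ L

HasECQ : ∀ {ℓ} → Logic ℓ → Set ℓ
HasECQ L = ∀ p q → Logic._⊢_ L (pair (atom p) (∼ atom p)) (atom q)

-- ECQ: the least logic extending B in which the ECQ rule holds,
-- i.e. the intersection of all such logics.
_⊢ECQ_ : Rel (lsuc lzero)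
Γ ⊢ECQ φ = ∀ (L : Logic lzero) → Extends L → HasECQ L → Logic._⊢_ L Γ φ

HasInterpolation : ∀ {ℓ} → Logic ℓ → Set ℓ
HasInterpolation L = ∀ φ ψ → ｛ φ ｝ ⊢ ψ →
  Σ Formula λ χ → (｛ φ ｝ ⊢ χ) × (｛ χ ｝ ⊢ ψ) ×
                  (∀ k → Occurs k χ → Occurs k φ × Occurs k ψ)
  where open Logic L

-- Order B4 by information: n below f and t, both below b. The operations of
-- B4 are monotone for this order and {t, b} is an up-set, so a valuation
-- carrying more information satisfies more formulas. Hence renaming each atom
-- by its value under a valuation v (t ↦ ⊤, f ↦ ⊥, n ↦ p₀, b ↦ p₁) turns a rule
-- of L refuted by v into a derivation from p₁ ∧ ∼p₁: of an arbitrary atom,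
-- i.e. ECQ, when v avoids n, and of p₀ ∨ ∼p₀ in general. So without ECQ,
-- L ⊆ LP; and as L ≠ B, p₁ ∧ ∼p₁ ⊢ p₀ ∨ ∼p₀ holds in L. An interpolant of the
-- latter has no atoms, hence a constant value, which without ECQ must be
-- designated; so ⊢ p₀ ∨ ∼p₀ in L, and that gives LP ⊆ L.
module Submission where

open import Defs
open import Level using (Lift; lift; lower) renaming (suc to lsuc; zero to lzero)
open import Data.Nat using (ℕ; zero; suc)
open import Data.Bool using (Bool; true; false; T; not) renaming (_∧_ to _and_; _∨_ to _or_)
open import Data.Unit using (tt)
open import Data.Empty using (⊥-elim)
open import Data.Product using (Σ; _,_; proj₁; proj₂)
open import Data.Sum using (_⊎_; inj₁; inj₂; [_,_])
open import Function using (_∘_; id)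
open import Relation.Nullary using (¬_; Dec; yes; no)
open import Relation.Nullary.Decidable using (map′; decidable-stable)
open import Relation.Unary using (∅)
open import Relation.Binary.PropositionalEquality using (_≡_; _≢_; refl; sym; cong; cong₂; subst)
open import Axiom.ExcludedMiddle using (ExcludedMiddle)

infix 4 _≤ₖ?_ _≤ₖ_ _≤ₖ*_ _⊨_ _⊨*_

_≤ₖ?_ : B4 → B4 → Bool
n ≤ₖ? _ = true
f ≤ₖ? f = true
t ≤ₖ? t = true
_ ≤ₖ? b = true
_ ≤ₖ? _ = false

_≤ₖ_ : B4 → B4 → Set
x ≤ₖ y = T (x ≤ₖ? y)

≤ₖ-b : ∀ x → x ≤ₖ b
≤ₖ-b f = tt
≤ₖ-b n = tt
≤ₖ-b b = tt
≤ₖ-b t = tt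

record Every (P : B4 → Set) : Set where
  constructor every-of
  field
    at-f : P f
    at-n : P n
    at-b : P b
    at-t : P t

every : ∀ {P} → Every P → ∀ x → P x
every (every-of p _ _ _) f = p
every (every-of _ p _ _) n = p
every (every-of _ _ p _) b = p
every (every-of _ _ _ p) t = p

Implies : Bool → Bool → Set
Implies x y = T (not x or y)

modus-ponens : ∀ {x y} → Implies x y → T x → T y
modus-ponens {true} h _ = h

Monotoneₖ₂ : (B4 → B4 → B4) → Set
Monotoneₖ₂ _∙_ = ∀ {a a' c c'} → a ≤ₖ a' → c ≤ₖ c' → a ∙ c ≤ₖ a' ∙ c'

monotoneₖ₂ : ∀ _∙_ →
  (Every λ a → Every λ a' → Every λ c → Every λ c' →
     Implies (a ≤ₖ? a') (not (c ≤ₖ? c') or (a ∙ c ≤ₖ? a' ∙ c'))) →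
  Monotoneₖ₂ _∙_
monotoneₖ₂ _∙_ table {a} {a'} {c} {c'} a≤a' c≤c' =
  modus-ponens (modus-ponens (every (every (every (every table a) a') c) c') a≤a') c≤c'

-- Each table below is a closed record of ⊤s, which Agda fills in by η.
⊓-monoₖ : Monotoneₖ₂ _⊓_
⊓-monoₖ = monotoneₖ₂ _⊓_ _

⊔-monoₖ : Monotoneₖ₂ _⊔ᴮ_
⊔-monoₖ = monotoneₖ₂ _⊔ᴮ_ _

negᴮ-monoₖ : ∀ {a a'} → a ≤ₖ a' → negᴮ a ≤ₖ negᴮ a'
negᴮ-monoₖ {a} {a'} = modus-ponens (every (every table a) a')
  where
  table : Every λ a → Every λ a' → Implies (a ≤ₖ? a') (negᴮ a ≤ₖ? negᴮ a')
  table = _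

Des-≤ₖ : ∀ {x y} → x ≤ₖ y → Des x → Des y
Des-≤ₖ {y = b} _ _ = tt
Des-≤ₖ {t} {t} _ _ = tt
Des-≤ₖ {t} {f} ()
Des-≤ₖ {t} {n} ()
Des-≤ₖ {b} {f} ()
Des-≤ₖ {b} {n} ()
Des-≤ₖ {b} {t} ()

Des? : ∀ x → Dec (Des x)
Des? f = no λ ()
Des? n = no λ ()
Des? b = yes tt
Des? t = yes tt

Des-⊓ : ∀ {x y} → Des x → Des y → Des (x ⊓ y)
Des-⊓ {b} {b} _ _ = tt
Des-⊓ {b} {t} _ _ = tt
Des-⊓ {t} {b} _ _ = tt
Des-⊓ {t} {t} _ _ = tt

Des-glut⇒b : ∀ x → Des (x ⊓ negᴮ x) → x ≡ b
Des-glut⇒b b _ = refl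

¬Des-em⇒n : ∀ x → ¬ Des (x ⊔ᴮ negᴮ x) → x ≡ n
¬Des-em⇒n f ¬d = ⊥-elim (¬d tt)
¬Des-em⇒n n ¬d = refl
¬Des-em⇒n b ¬d = ⊥-elim (¬d tt)
¬Des-em⇒n t ¬d = ⊥-elim (¬d tt)

Des-em⇒≢n : ∀ x → Des (x ⊔ᴮ negᴮ x) → x ≢ n
Des-em⇒≢n n () refl

Valuation : Set
Valuation = ℕ → B4

_⊨_ : Valuation → Formula → Set
v ⊨ φ = Des (⟦ φ ⟧ v)

_⊨*_ : Valuation → FSet → Set
v ⊨* Γ = ∀ φ → Γ φ → v ⊨ φ

_≤ₖ*_ : Valuation → Valuation → Set
u ≤ₖ* u' = ∀ k → u k ≤ₖ u' k

⟦⟧-monoₖ : ∀ φ {u u'} → u ≤ₖ* u' → ⟦ φ ⟧ u ≤ₖ ⟦ φ ⟧ u'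
⟦⟧-monoₖ (atom k) u≤u' = u≤u' k
⟦⟧-monoₖ (φ ∧ ψ) u≤u' = ⊓-monoₖ (⟦⟧-monoₖ φ u≤u') (⟦⟧-monoₖ ψ u≤u')
⟦⟧-monoₖ (φ ∨ ψ) u≤u' = ⊔-monoₖ (⟦⟧-monoₖ φ u≤u') (⟦⟧-monoₖ ψ u≤u')
⟦⟧-monoₖ (∼ φ) u≤u' = negᴮ-monoₖ (⟦⟧-monoₖ φ u≤u')
⟦⟧-monoₖ top _ = tt
⟦⟧-monoₖ bot _ = tt

⊨-monoₖ : ∀ φ {u u'} → u ≤ₖ* u' → u ⊨ φ → u' ⊨ φ
⊨-monoₖ φ u≤u' = Des-≤ₖ (⟦⟧-monoₖ φ u≤u')

⟦_⟧ˢ : Subst → Valuation → Valuation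
⟦ σ ⟧ˢ w k = ⟦ σ k ⟧ w

⟦⟧-[] : ∀ φ σ w → ⟦ φ [ σ ] ⟧ w ≡ ⟦ φ ⟧ (⟦ σ ⟧ˢ w)
⟦⟧-[] (atom k) σ w = refl
⟦⟧-[] (φ ∧ ψ) σ w = cong₂ _⊓_ (⟦⟧-[] φ σ w) (⟦⟧-[] ψ σ w)
⟦⟧-[] (φ ∨ ψ) σ w = cong₂ _⊔ᴮ_ (⟦⟧-[] φ σ w) (⟦⟧-[] ψ σ w)
⟦⟧-[] (∼ φ) σ w = cong negᴮ (⟦⟧-[] φ σ w)
⟦⟧-[] top σ w = refl
⟦⟧-[] bot σ w = refl

⟦⟧-closed : ∀ φ → (∀ k → ¬ Occurs k φ) → ∀ u u' → ⟦ φ ⟧ u ≡ ⟦ φ ⟧ u'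
⟦⟧-closed (atom k) closed u u' = ⊥-elim (closed k here)
⟦⟧-closed (φ ∧ ψ) closed u u' =
  cong₂ _⊓_ (⟦⟧-closed φ (λ k → closed k ∘ ∧ˡ) u u') (⟦⟧-closed ψ (λ k → closed k ∘ ∧ʳ) u u')
⟦⟧-closed (φ ∨ ψ) closed u u' =
  cong₂ _⊔ᴮ_ (⟦⟧-closed φ (λ k → closed k ∘ ∨ˡ) u u') (⟦⟧-closed ψ (λ k → closed k ∘ ∨ʳ) u u')
⟦⟧-closed (∼ φ) closed u u' = cong negᴮ (⟦⟧-closed φ (λ k → closed k ∘ ∼i) u u')
⟦⟧-closed top _ u u' = refl
⟦⟧-closed bot _ u u' = refl

p₁∧∼p₁ p₀∨∼p₀ : Formula
p₁∧∼p₁ = atom 1 ∧ ∼ atom 1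
p₀∨∼p₀ = atom 0 ∨ ∼ atom 0

p₁∧∼p₁-p₀∨∼p₀-disjoint : ∀ k → Occurs k p₁∧∼p₁ → ¬ Occurs k p₀∨∼p₀
p₁∧∼p₁-p₀∨∼p₀-disjoint k (∧ˡ here) (∨ˡ ())
p₁∧∼p₁-p₀∨∼p₀-disjoint k (∧ˡ here) (∨ʳ (∼i ()))
p₁∧∼p₁-p₀∨∼p₀-disjoint k (∧ʳ (∼i here)) (∨ˡ ())
p₁∧∼p₁-p₀∨∼p₀-disjoint k (∧ʳ (∼i here)) (∨ʳ (∼i ()))

represent : B4 → Formula
represent f = bot
represent n = atom 0
represent b = atom 1
represent t = top

represent-above : ∀ x w → w 1 ≡ b → x ≤ₖ ⟦ represent x ⟧ w
represent-above f w _ = tt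
represent-above n w _ = tt
represent-above b w w₁≡b rewrite w₁≡b = tt
represent-above t w _ = tt

represent-below : ∀ x w → (x ≡ n → w 0 ≡ n) → ⟦ represent x ⟧ w ≤ₖ x
represent-below f w _ = tt
represent-below n w w₀≡n rewrite w₀≡n refl = tt
represent-below b w _ = ≤ₖ-b (w 1)
represent-below t w _ = tt

module _ (L : Logic lzero) (L-extends-B : Extends L) where
  open Logic L
  open IsLogic isLogic

  B⇒L : ∀ {Γ φ} → Γ ⊢B φ → Γ ⊢ φ
  B⇒L = L-extends-B _ _

  cut′ : ∀ {Γ Φ ψ} → (∀ φ → Φ φ → Γ ⊢ φ) → Φ ⊢ ψ → Γ ⊢ ψ
  cut′ Γ⊢Φ Φ⊢ψ = monotone (λ _ → [ id , id ]) (cut Γ⊢Φ (monotone (λ _ → inj₁) Φ⊢ψ))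

  ⊢-trans : ∀ {Γ χ ψ} → Γ ⊢ χ → ｛ χ ｝ ⊢ ψ → Γ ⊢ ψ
  ⊢-trans Γ⊢χ = cut′ λ { _ refl → Γ⊢χ }

  -- p₁ ∧ ∼p₁ forces p₁ = b, which makes the renamed valuation at least as
  -- informative as v; the failure of ψ must force it below v.
  glut⊢-of-refutation : ∀ {Γ φ} (v : Valuation) → Γ ⊢ φ → v ⊨* Γ → ¬ v ⊨ φ →
    ∀ ψ → (∀ w → ¬ w ⊨ ψ → ∀ k → v k ≡ n → w 0 ≡ n) → ｛ p₁∧∼p₁ ｝ ⊢ ψ
  glut⊢-of-refutation {Γ} {φ} v Γ⊢φ v⊨Γ v⊭φ ψ ψ-fails =
    ⊢-trans (cut′ glut⊢Γσ (structural σ Γ⊢φ)) (B⇒L φσ⊢ψ)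
    where
    σ : Subst
    σ = represent ∘ v

    glut⊢Γσ : ∀ χ → (Γ ⟨ σ ⟩) χ → ｛ p₁∧∼p₁ ｝ ⊢ χ
    glut⊢Γσ _ (χ , χ∈Γ , refl) = B⇒L λ w w⊨glut →
      let v≤σw = λ k → represent-above (v k) w (Des-glut⇒b (w 1) (w⊨glut _ refl))
      in subst Des (sym (⟦⟧-[] χ σ w)) (⊨-monoₖ χ v≤σw (v⊨Γ χ χ∈Γ))

    φσ⊢ψ : ｛ φ [ σ ] ｝ ⊢B ψ
    φσ⊢ψ w w⊨φσ = decidable-stable (Des? _) λ w⊭ψ →
      let σw≤v = λ k → represent-below (v k) w (ψ-fails w w⊭ψ k)
      in v⊭φ (⊨-monoₖ φ σw≤v (subst Des (⟦⟧-[] φ σ w) (w⊨φσ _ refl)))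

  ecq-of-glut⊢p₀ : ｛ p₁∧∼p₁ ｝ ⊢ atom 0 → HasECQ L
  ecq-of-glut⊢p₀ glut⊢p₀ p q =
    ⊢-trans (B⇒L λ w w⊨p∼p → Des-⊓ (w⊨p∼p _ (inj₁ refl)) (w⊨p∼p _ (inj₂ refl)))
            (monotone renamed-glut (structural τ glut⊢p₀))
    where
    τ : Subst
    τ zero = atom q
    τ (suc _) = atom p

    renamed-glut : (｛ p₁∧∼p₁ ｝ ⟨ τ ⟩) ⊆ ｛ atom p ∧ ∼ atom p ｝
    renamed-glut _ (_ , refl , refl) = refl

  ≤LP-unless-ECQ : ¬ HasECQ L → _⊢_ ≤ᴿ _⊢LP_
  ≤LP-unless-ECQ ¬ecq Γ φ Γ⊢φ v v≢n v⊨Γ = decidable-stable (Des? _) λ v⊭φ →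
    ¬ecq (ecq-of-glut⊢p₀ (glut⊢-of-refutation v Γ⊢φ v⊨Γ v⊭φ (atom 0) λ _ _ k → ⊥-elim ∘ v≢n k))

  ≤B-unless-glut⊢em : ¬ ｛ p₁∧∼p₁ ｝ ⊢ p₀∨∼p₀ → _⊢_ ≤ᴿ _⊢B_
  ≤B-unless-glut⊢em ¬glut⊢em Γ φ Γ⊢φ v v⊨Γ = decidable-stable (Des? _) λ v⊭φ →
    ¬glut⊢em (glut⊢-of-refutation v Γ⊢φ v⊨Γ v⊭φ p₀∨∼p₀ λ w w⊭em _ _ → ¬Des-em⇒n (w 0) w⊭em)

  LP≤-of-⊢em : ∅ ⊢ p₀∨∼p₀ → _⊢LP_ ≤ᴿ _⊢_
  LP≤-of-⊢em ⊢em Γ φ Γ⊢LPφ = cut′ {Φ = Instances ∪ Γ} Γ⊢Instances∪Γ (B⇒L Instances∪Γ⊢Bφ)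
    where
    Instances : FSet
    Instances ψ = Σ ℕ λ k → ψ ≡ atom k ∨ ∼ atom k

    Γ⊢Instances∪Γ : ∀ ψ → (Instances ∪ Γ) ψ → Γ ⊢ ψ
    Γ⊢Instances∪Γ _ (inj₁ (k , refl)) = monotone (λ { _ (_ , () , _) }) (structural (λ _ → atom k) ⊢em)
    Γ⊢Instances∪Γ ψ (inj₂ ψ∈Γ) = monotone (λ { _ refl → ψ∈Γ }) (reflexive ψ)

    Instances∪Γ⊢Bφ : (Instances ∪ Γ) ⊢B φ
    Instances∪Γ⊢Bφ w w⊨ = Γ⊢LPφ w (λ k → Des-em⇒≢n (w k) (w⊨ _ (inj₁ (k , refl)))) (λ ψ → w⊨ ψ ∘ inj₂)

  closed-theorem-or-explosive : ∀ χ → (∀ k → ¬ Occurs k χ) → ∅ ⊢ χ ⊎ (∀ ψ → ｛ χ ｝ ⊢ ψ)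
  closed-theorem-or-explosive χ closed with Des? (⟦ χ ⟧ (λ _ → t))
  ... | yes designated = inj₁ (B⇒L λ w _ → subst Des (⟦⟧-closed χ closed _ w) designated)
  ... | no undesignated = inj₂ λ ψ → B⇒L λ w w⊨χ →
          ⊥-elim (undesignated (subst Des (⟦⟧-closed χ closed w _) (w⊨χ _ refl)))

  ⊢em-or-ECQ : HasInterpolation L → ｛ p₁∧∼p₁ ｝ ⊢ p₀∨∼p₀ → ∅ ⊢ p₀∨∼p₀ ⊎ HasECQ L
  ⊢em-or-ECQ interpolation glut⊢em with interpolation _ _ glut⊢em
  ... | χ , glut⊢χ , χ⊢em , shared with closed-theorem-or-explosive χ closed
    where
    closed : ∀ k → ¬ Occurs k χ
    closed k k∈χ = p₁∧∼p₁-p₀∨∼p₀-disjoint k (proj₁ (shared k k∈χ)) (proj₂ (shared k k∈χ))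
  ...   | inj₁ ⊢χ = inj₁ (⊢-trans ⊢χ χ⊢em)
  ...   | inj₂ χ⊢ = inj₂ (ecq-of-glut⊢p₀ (⊢-trans glut⊢χ (χ⊢ (atom 0))))

decide : ExcludedMiddle (lsuc lzero) → (P : Set) → Dec P
decide lem P = map′ lower lift (lem {Lift (lsuc lzero) P})

proposition5p4 : ExcludedMiddle (lsuc lzero) →
    (L : Logic lzero) → Extends L → ¬ (Logic._⊢_ L ≈ᴿ _⊢B_) →
    HasInterpolation L →
    (Logic._⊢_ L ≈ᴿ _⊢LP_) ⊎ (_⊢ECQ_ ≤ᴿ Logic._⊢_ L)
proposition5p4 lem L L-extends-B L≉B interpolation with decide lem (HasECQ L)
... | yes ecq = inj₂ λ Γ φ Γ⊢ECQφ → Γ⊢ECQφ L L-extends-B ecq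
... | no ¬ecq = inj₁ (≤LP-unless-ECQ L L-extends-B ¬ecq , LP≤-of-⊢em L L-extends-B ⊢em)
  where
  open Logic L

  ¬¬⊢em : ¬ ¬ ∅ ⊢ p₀∨∼p₀
  ¬¬⊢em ¬⊢em = L≉B (≤B-unless-glut⊢em L L-extends-B ¬glut⊢em , L-extends-B)
    where
    ¬glut⊢em : ¬ ｛ p₁∧∼p₁ ｝ ⊢ p₀∨∼p₀
    ¬glut⊢em = [ ¬⊢em , ¬ecq ] ∘ ⊢em-or-ECQ L L-extends-B interpolation

  ⊢em : ∅ ⊢ p₀∨∼p₀
  ⊢em = decidable-stable (decide lem _) ¬¬⊢em
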